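{- Let $F$ be a finite field with $|F|\ge7$, let $q$ be an anisotropic non-degenerate quadratic form of dimension $2$ over $F$, and let $a\in F^\ast$. Then $\mathrm{diam}(\mathcal{G}_{q,a})\ge3$.
   Context: A quadratic form on a finite-dimensional $F$-vector space $V$ is a map $q:V\to F$ with $q(\lambda x)=\lambda^2q(x)$ such that $b_q(x,y)=q(x+y)-q(x)-q(y)$ is bilinear; non-degenerate means $\{x: b_q(x,y)=0\ \forall y\}=\{0\}$; anisotropic means $q(v)\ne0$ for all $v\ne0$. The representation graph $\mathcal{G}_{q,a}$ has vertex set $V$, with distinct $x,y$ adjacent iff $q(x-y)=a$; the diameter is the supremum of shortest-path distances ($\infty$ if disconnected). -}

module Defs where

open import Level using (Level; _⊔_) renaming (suc to lsuc)
open import Data.Nat using (ℕ; zero; suc; _≤_)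
open import Data.Fin using (Fin)
open import Data.Product using (_×_; _,_; Σ; ∃; ∃-syntax)
open import Relation.Binary.PropositionalEquality using (_≡_; _≢_)
open import Relation.Nullary using (¬_)
open import Function.Bundles using (_↔_)
open import Algebra.Structures using (IsCommutativeRing)

record FiniteField (c : Level) : Set (lsuc c) where
  infixl 6 _+_
  infixl 7 _*_
  field
    Carrier : Set c
    _+_ _*_ : Carrier → Carrier → Carrier
    -_      : Carrier → Carrier
    0# 1#   : Carrier
    isCommutativeRing : IsCommutativeRing {A = Carrier} _≡_ _+_ _*_ -_ 0# 1#
    1≢0     : 1# ≢ 0#
    inverse : ∀ x → x ≢ 0# → ∃[ y ] (x * y ≡ 1#)
    size    : ℕ
    enum    : Fin size ↔ Carrier

module _ {c : Level} (F : FiniteField c) where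
  open FiniteField F

  V : Set c
  V = Carrier × Carrier

  0V : V
  0V = 0# , 0#

  _+V_ : V → V → V
  (x₁ , x₂) +V (y₁ , y₂) = (x₁ + y₁) , (x₂ + y₂)

  -V_ : V → V
  -V (x₁ , x₂) = (- x₁) , (- x₂)

  _-V_ : V → V → V
  x -V y = x +V (-V y)

  _·_ : Carrier → V → V
  λ' · (x₁ , x₂) = (λ' * x₁) , (λ' * x₂)

  polar : (V → Carrier) → V → V → Carrier
  polar q x y = (q (x +V y) + (- q x)) + (- q y)

  record IsQuadraticForm (q : V → Carrier) : Set c where
    field
      homog    : ∀ λ' x → q (λ' · x) ≡ (λ' * λ') * q x
      addˡ     : ∀ x x' y → polar q (x +V x') y ≡ polar q x y + polar q x' y
      scaleˡ   : ∀ λ' x y → polar q (λ' · x) y ≡ λ' * polar q x y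
      addʳ     : ∀ x y y' → polar q x (y +V y') ≡ polar q x y + polar q x y'
      scaleʳ   : ∀ λ' x y → polar q x (λ' · y) ≡ λ' * polar q x y

  NonDegenerate : (V → Carrier) → Set c
  NonDegenerate q = ∀ x → (∀ y → polar q x y ≡ 0#) → x ≡ 0V

  Anisotropic : (V → Carrier) → Set c
  Anisotropic q = ∀ v → v ≢ 0V → q v ≢ 0#

  Adj : (V → Carrier) → Carrier → V → V → Set c
  Adj q a x y = (x ≢ y) × (q (x -V y) ≡ a)

data Walk {c : Level} {A : Set c} (E : A → A → Set c) : A → A → ℕ → Set c where
  here  : ∀ {x} → Walk E x x zero
  step  : ∀ {x y z n} → E x y → Walk E y z n → Walk E x z (suc n)

-- diam(G) ≥ k  (diameter = sup of distances, ∞ if disconnected):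
-- there are vertices x, y with d(x,y) ≥ k, i.e. every walk from x to y
-- (hence every shortest path) has length ≥ k (vacuous if none exists).
DiamAtLeast : {c : Level} {A : Set c} → (A → A → Set c) → ℕ → Set c
DiamAtLeast {A = A} E k = Σ A λ x → Σ A λ y → ∀ n → Walk E x y n → k ≤ n

{-# OPTIONS --safe #-}
module Submission where

-- Pick d whose value n = q d avoids 0, a, -a and the two roots of (n + a)² = a n, and let
-- y = c d with c = -(n + a)/n.  Then q y = (n + a)²/n is neither 0 nor a, so y is not within
-- distance 1 of 0.  A common neighbour z of 0 and y would satisfy b(z, d) = c n = -(n + a), hence
-- q (z + d) = 0, so z = -d and a = q z = n, which is excluded.  Such a d exists by counting: by
-- anisotropy each line through p meets the level set of q p in at most one further point, so each
-- level set has at most |F| + 2 elements, and 5 (|F| + 2) < |F|² once |F| ≥ 7.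

open import Defs
open import Level using (Level)
open import Data.Nat using (_≤_)
open import Relation.Binary.PropositionalEquality using (_≢_)

open import Algebra.Bundles using (CommutativeRing)
open import Data.Nat as ℕ using (ℕ; suc; _<_; z≤n; s≤s)
open import Data.Nat.Properties
  using (≤-refl; ≤-reflexive; ≤-trans; ≤-<-trans; +-mono-≤; *-monoˡ-≤; *-monoʳ-≤; *-distribˡ-+; *-distribʳ-+; +-monoˡ-<; m≤m+n; module ≤-Reasoning)
open import Data.Fin as Fin using (Fin)
open import Data.Fin.Properties using (any?; ¬∀⟶∃¬; pigeonhole; <⇒≢; *↔×)
open import Data.Product as Product using (∃; ∃-syntax; ∃₂; _×_; _,_; proj₁; proj₂; map₂; uncurry)
open import Data.Product.Function.NonDependent.Propositional using (_×-↔_)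
open import Data.Sum using (_⊎_; inj₁; inj₂; [_,_])
open import Data.List as List using (List; []; _∷_; _++_; length; map; allFin)
open import Data.List.Properties using (length-++; length-map; length-tabulate)
open import Data.List.Relation.Unary.Any using (here; there; index)
open import Data.List.Relation.Unary.Any.Properties using (lookup-index)
open import Data.List.Membership.Propositional using (_∈_; _∉_)
open import Data.List.Membership.Propositional.Properties using (∈-++⁺ˡ; ∈-++⁺ʳ; ∈-map⁺; ∈-map⁻; ∈-allFin)
import Data.List.Membership.DecPropositional as DecMembership
open import Data.Empty using (⊥-elim)
open import Function using (_∘_; id; _↔_; Inverse; Injection)
open import Function.Properties.Inverse using (↔-trans; ↔-sym; ↔⇒↣)
open import Relation.Nullary using (¬_; Dec; yes; no)
open import Relation.Nullary.Decidable using (map′; via-injection)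
open import Relation.Unary using (Pred; _⊆_; ∁; Decidable)
open import Relation.Binary.Definitions using (DecidableEquality)
open import Relation.Binary.PropositionalEquality
  using (_≡_; refl; sym; trans; cong; cong₂; subst; module ≡-Reasoning)

private
  variable
    a b p : Level
    A : Set a
    B : Set b
    P Q : Pred A p

AtMost : ℕ → Pred A p → Set _
AtMost k P = ∃[ xs ] (length xs ≤ k × P ⊆ (_∈ xs))

atMost-mono : ∀ {k l} → k ≤ l → P ⊆ Q → AtMost k Q → AtMost l P
atMost-mono k≤l P⊆Q (xs , |xs|≤k , Q⊆xs) = xs , ≤-trans |xs|≤k k≤l , Q⊆xs ∘ P⊆Q

atMost-≡ : (y : A) → AtMost 1 (_≡ y)
atMost-≡ y = y ∷ [] , ≤-refl , λ { refl → here refl }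

atMost-⊎ : ∀ {m n} → AtMost m P → AtMost n Q → AtMost (m ℕ.+ n) (λ x → P x ⊎ Q x)
atMost-⊎ (xs , |xs|≤m , P⊆xs) (ys , |ys|≤n , Q⊆ys) =
  xs ++ ys ,
  ≤-trans (≤-reflexive (length-++ xs)) (+-mono-≤ |xs|≤m |ys|≤n) ,
  [ ∈-++⁺ˡ ∘ P⊆xs , ∈-++⁺ʳ xs ∘ Q⊆ys ]

atMost-preimage : ∀ {m n} (f : A → B) → AtMost m P →
                  (∀ y → AtMost n (λ x → f x ≡ y)) → AtMost (m ℕ.* n) (P ∘ f)
atMost-preimage {n = n} f (ys , |ys|≤m , P⊆ys) fibre =
  atMost-mono (*-monoˡ-≤ n |ys|≤m) P⊆ys (fibres ys)
  where
  fibres : ∀ ys → AtMost (length ys ℕ.* n) (λ x → f x ∈ ys)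
  fibres []       = [] , z≤n , λ ()
  fibres (y ∷ ys) = atMost-mono ≤-refl (λ { (here e) → inj₁ e ; (there e) → inj₂ e })
                                (atMost-⊎ (fibre y) (fibres ys))

module _ {n} (enum : Fin n ↔ A) where
  open Inverse enum using (to; from; strictlyInverseˡ)

  ≟-from-enum : DecidableEquality A
  ≟-from-enum = via-injection (↔⇒↣ (↔-sym enum)) Fin._≟_

  any?-from-enum : {P : Pred A p} → Decidable P → Dec (∃ P)
  any?-from-enum {P = P} P? =
    map′ (λ (i , pi) → to i , pi) (λ (x , px) → from x , subst P (sym (strictlyInverseˡ x)) px) (any? (P? ∘ to))

  elements : List A
  elements = map to (allFin n)

  ∈-elements : ∀ x → x ∈ elements
  ∈-elements x = subst (_∈ elements) (strictlyInverseˡ x) (∈-map⁺ to (∈-allFin (from x)))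

  length-elements : length elements ≡ n
  length-elements = trans (length-map to (allFin n)) (length-tabulate _)

  short-list⇒∃∉ : (xs : List A) → length xs < n → ∃ (_∉ xs)
  short-list⇒∃∉ xs |xs|<n = Product.map to id (¬∀⟶∃¬ n (λ i → to i ∈ xs) (λ i → to i ∈? xs) all∈)
    where
    open DecMembership ≟-from-enum using (_∈?_)
    all∈ : ¬ (∀ i → to i ∈ xs)
    all∈ to∈ with pigeonhole |xs|<n (index ∘ to∈)
    ... | i , j , i<j , same-index = <⇒≢ i<j (Injection.injective (↔⇒↣ enum) (begin
      to i                 ≡⟨ lookup-index (to∈ i) ⟩
      List.lookup xs _     ≡⟨ cong (List.lookup xs) same-index ⟩
      List.lookup xs _     ≡⟨ sym (lookup-index (to∈ j)) ⟩
      to j                 ∎))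
      where open ≡-Reasoning

  atMost⇒∃∁ : ∀ {m} {P : Pred A p} → AtMost m P → m < n → ∃ (∁ P)
  atMost⇒∃∁ (xs , |xs|≤m , P⊆xs) m<n = map₂ (_∘ P⊆xs) (short-list⇒∃∉ xs (≤-<-trans |xs|≤m m<n))

module _ {A : Set a} {E : A → A → Set a} {x y : A} where

  no-short-walk⇒diamAtLeast3 : x ≢ y → ¬ E x y → (∀ {z} → E x z → ¬ E z y) → DiamAtLeast E 3
  no-short-walk⇒diamAtLeast3 x≢y ¬E-x-y ¬E-x-z-y = x , y , length≥3
    where
    length≥3 : ∀ n → Walk E x y n → 3 ≤ n
    length≥3 _ here                         = ⊥-elim (x≢y refl)
    length≥3 _ (step x-y here)              = ⊥-elim (¬E-x-y x-y)
    length≥3 _ (step x-z (step z-y here))   = ⊥-elim (¬E-x-z-y x-z z-y)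
    length≥3 _ (step _ (step _ (step _ _))) = s≤s (s≤s (s≤s z≤n))

module _ {ℓ} (F : FiniteField ℓ) where
  open FiniteField F

  commutativeRing : CommutativeRing ℓ ℓ
  commutativeRing = record { isCommutativeRing = isCommutativeRing }

  open CommutativeRing commutativeRing
    using (+-assoc; +-comm; +-identityˡ; -‿inverseʳ; *-assoc; *-comm;
           *-identityˡ; *-identityʳ; zeroˡ; zeroʳ; distribˡ; ring; +-abelianGroup; commutativeSemiring; *-commutativeSemigroup)
  open import Algebra.Properties.CommutativeSemigroup *-commutativeSemigroup using (x∙yz≈y∙xz; interchange)
  open import Algebra.Properties.Ring ring using (-1*x≈-x; -‿distribˡ-*; -‿distribʳ-*)
  open import Algebra.Properties.AbelianGroup +-abelianGroup
    using (inverseˡ-unique; identityʳ-unique; x∙y⁻¹≈ε⇒x≈y; ⁻¹-involutive; ε⁻¹≈ε; ∙-cancelʳ)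
  open ≡-Reasoning

  infix 4 _≟_
  _≟_ : DecidableEquality Carrier
  _≟_ = ≟-from-enum enum

  infix 8 _⁻¹
  _⁻¹ : Carrier → Carrier
  x ⁻¹ with x ≟ 0#
  ... | yes _   = 0#
  ... | no x≢0 = proj₁ (inverse x x≢0)

  ⁻¹-inverseʳ : ∀ {x} → x ≢ 0# → x * x ⁻¹ ≡ 1#
  ⁻¹-inverseʳ {x} x≢0 with x ≟ 0#
  ... | yes x≡0  = ⊥-elim (x≢0 x≡0)
  ... | no x≢0′ = proj₂ (inverse x x≢0′)

  ⁻¹-cancelˡ : ∀ {x} y → x ≢ 0# → x ⁻¹ * (x * y) ≡ y
  ⁻¹-cancelˡ {x} y x≢0 = begin
    x ⁻¹ * (x * y)   ≡⟨ sym (*-assoc _ _ _) ⟩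
    x ⁻¹ * x * y     ≡⟨ cong (_* y) (trans (*-comm _ _) (⁻¹-inverseʳ x≢0)) ⟩
    1# * y           ≡⟨ *-identityˡ y ⟩
    y                ∎

  *-cancelˡ : ∀ {x y z} → x ≢ 0# → x * y ≡ x * z → y ≡ z
  *-cancelˡ {x} {y} {z} x≢0 xy≡xz = begin
    y                ≡⟨ sym (⁻¹-cancelˡ y x≢0) ⟩
    x ⁻¹ * (x * y)   ≡⟨ cong (x ⁻¹ *_) xy≡xz ⟩
    x ⁻¹ * (x * z)   ≡⟨ ⁻¹-cancelˡ z x≢0 ⟩
    z                ∎

  *-≢0 : ∀ {x y} → x ≢ 0# → y ≢ 0# → x * y ≢ 0#
  *-≢0 {x} x≢0 y≢0 xy≡0 = y≢0 (*-cancelˡ x≢0 (trans xy≡0 (sym (zeroʳ x))))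

  x*y≡z⇒x≡z*y⁻¹ : ∀ {x y z} → y ≢ 0# → x * y ≡ z → x ≡ z * y ⁻¹
  x*y≡z⇒x≡z*y⁻¹ {x} {y} {z} y≢0 xy≡z = begin
    x                ≡⟨ sym (*-identityʳ x) ⟩
    x * 1#           ≡⟨ cong (x *_) (sym (⁻¹-inverseʳ y≢0)) ⟩
    x * (y * y ⁻¹)   ≡⟨ sym (*-assoc _ _ _) ⟩
    x * y * y ⁻¹     ≡⟨ cong (_* y ⁻¹) xy≡z ⟩
    z * y ⁻¹         ∎

  x+[y-x]≡y : ∀ x y → x + (y + - x) ≡ y
  x+[y-x]≡y x y = begin
    x + (y + - x)    ≡⟨ cong (x +_) (+-comm y (- x)) ⟩
    x + (- x + y)    ≡⟨ sym (+-assoc _ _ _) ⟩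
    x + - x + y      ≡⟨ cong (_+ y) (-‿inverseʳ x) ⟩
    0# + y           ≡⟨ +-identityˡ y ⟩
    y                ∎

  -‿≢0 : ∀ {x} → x ≢ 0# → - x ≢ 0#
  -‿≢0 {x} x≢0 -x≡0 = x≢0 (begin
    x                ≡⟨ sym (⁻¹-involutive x) ⟩
    - - x            ≡⟨ cong -_ -x≡0 ⟩
    - 0#             ≡⟨ ε⁻¹≈ε ⟩
    0#               ∎)

  x*y⁻¹*y≡x : ∀ {y} x → y ≢ 0# → x * y ⁻¹ * y ≡ x
  x*y⁻¹*y≡x {y} x y≢0 = begin
    x * y ⁻¹ * y     ≡⟨ *-assoc _ _ _ ⟩
    x * (y ⁻¹ * y)   ≡⟨ cong (x *_) (trans (*-comm _ _) (⁻¹-inverseʳ y≢0)) ⟩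
    x * 1#           ≡⟨ *-identityʳ x ⟩
    x                ∎

  -x*-y≡x*y : ∀ x y → - x * - y ≡ x * y
  -x*-y≡x*y x y = begin
    - x * - y        ≡⟨ sym (-‿distribˡ-* x (- y)) ⟩
    - (x * - y)      ≡⟨ cong -_ (sym (-‿distribʳ-* x y)) ⟩
    - - (x * y)      ≡⟨ ⁻¹-involutive _ ⟩
    x * y            ∎

  -- (n - r)(n + r + a) = ((n + a)² - a n) - ((r + a)² - a r), rearranged so that no subtraction occurs.
  conjugate-root-identity : ∀ n r a → n * (n + r + a) + ((r + a) * (r + a) + a * n)
                                    ≡ r * (n + r + a) + ((n + a) * (n + a) + a * r)
  conjugate-root-identity =
    solve 3 (λ n r a → n :* (n :+ r :+ a) :+ ((r :+ a) :* (r :+ a) :+ a :* n)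
                    := r :* (n :+ r :+ a) :+ ((n :+ a) :* (n :+ a) :+ a :* r)) refl
    where open import Algebra.Solver.Ring.NaturalCoefficients.Default commutativeSemiring

  roots-are-conjugate : ∀ {a r n} → (r + a) * (r + a) ≡ a * r → (n + a) * (n + a) ≡ a * n →
                        n ≡ r ⊎ n ≡ - (r + a)
  roots-are-conjugate {a} {r} {n} r-root n-root with n + r + a ≟ 0#
  ... | yes s≡0 = inj₂ (inverseˡ-unique n (r + a) (trans (sym (+-assoc n r a)) s≡0))
  ... | no s≢0  = inj₁ (*-cancelˡ s≢0 (trans (*-comm _ n) (trans ns≡rs (*-comm r _))))
    where
    s = n + r + a
    ns≡rs : n * s ≡ r * s
    ns≡rs = ∙-cancelʳ (a * r + a * n) (n * s) (r * s) (begin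
      n * s + (a * r + a * n)               ≡⟨ cong (λ t → n * s + (t + a * n)) (sym r-root) ⟩
      n * s + ((r + a) * (r + a) + a * n)   ≡⟨ conjugate-root-identity n r a ⟩
      r * s + ((n + a) * (n + a) + a * r)   ≡⟨ cong (λ t → r * s + (t + a * r)) n-root ⟩
      r * s + (a * n + a * r)               ≡⟨ cong (r * s +_) (+-comm _ _) ⟩
      r * s + (a * r + a * n)               ∎)

  roots-atMost : ∀ a → AtMost 2 (λ n → (n + a) * (n + a) ≡ a * n)
  roots-atMost a with any?-from-enum enum (λ r → (r + a) * (r + a) ≟ a * r)
  ... | no no-root       = [] , z≤n , λ {n} n-root → ⊥-elim (no-root (n , n-root))
  ... | yes (r , r-root) = r ∷ - (r + a) ∷ [] , ≤-refl , conjugates ∘ roots-are-conjugate r-root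
    where
    conjugates : ∀ {n} → n ≡ r ⊎ n ≡ - (r + a) → n ∈ r ∷ - (r + a) ∷ []
    conjugates = [ here , there ∘ here ]

  farScale : Carrier → Carrier → Carrier
  farScale a n = - (n + a) * n ⁻¹

  -- The values n = q d for which farScale a n ·ᵥ d need not be at distance 3 from 0ᵥ.
  BadValue : Carrier → Carrier → Set ℓ
  BadValue a n = n ≡ 0# ⊎ n ≡ a ⊎ n ≡ - a ⊎ (n + a) * (n + a) ≡ a * n

  badValues-atMost : ∀ a → AtMost 5 (BadValue a)
  badValues-atMost a =
    atMost-⊎ (atMost-≡ 0#) (atMost-⊎ (atMost-≡ a) (atMost-⊎ (atMost-≡ (- a)) (roots-atMost a)))

  module _ {a n} (good : ¬ BadValue a n) where

    farScale*n≡-[n+a] : farScale a n * n ≡ - (n + a)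
    farScale*n≡-[n+a] = x*y⁻¹*y≡x _ (good ∘ inj₁)

    farScale≢0 : farScale a n ≢ 0#
    farScale≢0 c≡0 = -‿≢0 n+a≢0 (begin
      - (n + a)          ≡⟨ farScale*n≡-[n+a] ⟨
      farScale a n * n   ≡⟨ cong (_* n) c≡0 ⟩
      0# * n             ≡⟨ zeroˡ n ⟩
      0#                 ∎)
      where
      n+a≢0 : n + a ≢ 0#
      n+a≢0 = good ∘ inj₂ ∘ inj₂ ∘ inj₁ ∘ inverseˡ-unique n a

    farScale²*n≢0 : farScale a n * farScale a n * n ≢ 0#
    farScale²*n≢0 = *-≢0 (*-≢0 farScale≢0 farScale≢0) (good ∘ inj₁)

    farScale²*n≢a : farScale a n * farScale a n * n ≢ a
    farScale²*n≢a c²n≡a = good (inj₂ (inj₂ (inj₂ (begin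
      (n + a) * (n + a)           ≡⟨ -x*-y≡x*y _ _ ⟨
      - (n + a) * - (n + a)       ≡⟨ cong₂ _*_ farScale*n≡-[n+a] farScale*n≡-[n+a] ⟨
      c * n * (c * n)             ≡⟨ interchange c n c n ⟩
      c * c * (n * n)             ≡⟨ *-assoc (c * c) n n ⟨
      c * c * n * n               ≡⟨ cong (_* n) c²n≡a ⟩
      a * n                       ∎))))
      where
      c = farScale a n

  infixl 6 _+ᵥ_ _-ᵥ_
  infix 7 -ᵥ_
  infixr 8 _·ᵥ_

  0ᵥ : V F
  0ᵥ = 0V F

  _+ᵥ_ _-ᵥ_ : V F → V F → V F
  _+ᵥ_ = _+V_ F
  _-ᵥ_ = _-V_ F

  -ᵥ_ : V F → V F
  -ᵥ_ = -V_ F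

  _·ᵥ_ : Carrier → V F → V F
  _·ᵥ_ = _·_ F

  enumV : Fin (size ℕ.* size) ↔ V F
  enumV = ↔-trans *↔× (enum ×-↔ enum)

  infix 4 _≟ᵥ_
  _≟ᵥ_ : DecidableEquality (V F)
  _≟ᵥ_ = ≟-from-enum enumV

  +ᵥ-identityˡ : ∀ w → 0ᵥ +ᵥ w ≡ w
  +ᵥ-identityˡ (w₁ , w₂) = cong₂ _,_ (+-identityˡ w₁) (+-identityˡ w₂)

  +ᵥ-sub : ∀ x y → x +ᵥ (y -ᵥ x) ≡ y
  +ᵥ-sub (x₁ , x₂) (y₁ , y₂) = cong₂ _,_ (x+[y-x]≡y x₁ y₁) (x+[y-x]≡y x₂ y₂)

  -ᵥ≡-1·ᵥ : ∀ w → -ᵥ w ≡ - 1# ·ᵥ w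
  -ᵥ≡-1·ᵥ (w₁ , w₂) = cong₂ _,_ (sym (-1*x≈-x w₁)) (sym (-1*x≈-x w₂))

  ·ᵥ-zeroˡ : ∀ w → 0# ·ᵥ w ≡ 0ᵥ
  ·ᵥ-zeroˡ (w₁ , w₂) = cong₂ _,_ (zeroˡ w₁) (zeroˡ w₂)

  +ᵥ≡0ᵥ⇒≡-ᵥ : ∀ {x y} → x +ᵥ y ≡ 0ᵥ → x ≡ -ᵥ y
  +ᵥ≡0ᵥ⇒≡-ᵥ {x₁ , x₂} {y₁ , y₂} x+y≡0 =
    cong₂ _,_ (inverseˡ-unique x₁ y₁ (cong proj₁ x+y≡0)) (inverseˡ-unique x₂ y₂ (cong proj₂ x+y≡0))

  -ᵥ≡0ᵥ⇒≡ : ∀ {x y} → x -ᵥ y ≡ 0ᵥ → x ≡ y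
  -ᵥ≡0ᵥ⇒≡ {x₁ , x₂} {y₁ , y₂} x-y≡0 =
    cong₂ _,_ (x∙y⁻¹≈ε⇒x≈y x₁ y₁ (cong proj₁ x-y≡0)) (x∙y⁻¹≈ε⇒x≈y x₂ y₂ (cong proj₂ x-y≡0))

  -- One representative of each line through the origin.
  directions : List (V F)
  directions = (0# , 1#) ∷ map (1# ,_) (elements enum)

  length-directions : length directions ≡ suc size
  length-directions = cong suc (trans (length-map (1# ,_) (elements enum)) (length-elements enum))

  direction-≢0ᵥ : ∀ {e} → e ∈ directions → e ≢ 0ᵥ
  direction-≢0ᵥ (here refl) e≡0 = 1≢0 (cong proj₂ e≡0)
  direction-≢0ᵥ (there e∈) e≡0 with ∈-map⁻ (1# ,_) e∈
  ... | _ , _ , refl = 1≢0 (cong proj₁ e≡0)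

  ≢0ᵥ⇒multiple-of-direction : ∀ {w} → w ≢ 0ᵥ → ∃₂ λ l e → e ∈ directions × l ≢ 0# × w ≡ l ·ᵥ e
  ≢0ᵥ⇒multiple-of-direction {w₁ , w₂} w≢0 with w₁ ≟ 0#
  ... | yes refl  = w₂ , (0# , 1#) , here refl , w₂≢0 , cong₂ _,_ (sym (zeroʳ w₂)) (sym (*-identityʳ w₂))
    where
    w₂≢0 : w₂ ≢ 0#
    w₂≢0 w₂≡0 = w≢0 (cong (0# ,_) w₂≡0)
  ... | no w₁≢0 = w₁ , (1# , w₂ * w₁ ⁻¹) , there (∈-map⁺ (1# ,_) (∈-elements enum _)) , w₁≢0 ,
                  cong₂ _,_ (sym (*-identityʳ w₁)) (sym w₁*[w₂*w₁⁻¹]≡w₂)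
    where
    w₁*[w₂*w₁⁻¹]≡w₂ : w₁ * (w₂ * w₁ ⁻¹) ≡ w₂
    w₁*[w₂*w₁⁻¹]≡w₂ = begin
      w₁ * (w₂ * w₁ ⁻¹)   ≡⟨ x∙yz≈y∙xz w₁ w₂ (w₁ ⁻¹) ⟩
      w₂ * (w₁ * w₁ ⁻¹)   ≡⟨ cong (w₂ *_) (⁻¹-inverseʳ w₁≢0) ⟩
      w₂ * 1#             ≡⟨ *-identityʳ w₂ ⟩
      w₂                  ∎

  module _ {q : V F → Carrier} (isQ : IsQuadraticForm F q) where
    open IsQuadraticForm isQ

    q-0ᵥ : q 0ᵥ ≡ 0#
    q-0ᵥ = begin
      q 0ᵥ              ≡⟨ cong q (sym (·ᵥ-zeroˡ 0ᵥ)) ⟩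
      q (0# ·ᵥ 0ᵥ)      ≡⟨ homog 0# 0ᵥ ⟩
      0# * 0# * q 0ᵥ    ≡⟨ *-assoc _ _ _ ⟩
      0# * (0# * q 0ᵥ)  ≡⟨ zeroˡ _ ⟩
      0#                ∎

    q-neg : ∀ x → q (-ᵥ x) ≡ q x
    q-neg x = begin
      q (-ᵥ x)              ≡⟨ cong q (-ᵥ≡-1·ᵥ x) ⟩
      q (- 1# ·ᵥ x)         ≡⟨ homog (- 1#) x ⟩
      - 1# * - 1# * q x     ≡⟨ cong (_* q x) (-x*-y≡x*y 1# 1#) ⟩
      1# * 1# * q x         ≡⟨ cong (_* q x) (*-identityˡ 1#) ⟩
      1# * q x              ≡⟨ *-identityˡ (q x) ⟩
      q x                   ∎

    q-0ᵥ-ᵥ : ∀ x → q (0ᵥ -ᵥ x) ≡ q x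
    q-0ᵥ-ᵥ x = trans (cong q (+ᵥ-identityˡ (-ᵥ x))) (q-neg x)

    q-+ᵥ : ∀ x y → q (x +ᵥ y) ≡ q x + q y + polar F q x y
    q-+ᵥ x y = sym (begin
      q x + q y + polar F q x y                         ≡⟨ +-assoc _ _ _ ⟩
      q x + (q y + (q (x +ᵥ y) + - q x + - q y))       ≡⟨ cong (q x +_) (x+[y-x]≡y _ _) ⟩
      q x + (q (x +ᵥ y) + - q x)                        ≡⟨ x+[y-x]≡y _ _ ⟩
      q (x +ᵥ y)                                        ∎)

    polar-negʳ : ∀ x y → polar F q x (-ᵥ y) ≡ - polar F q x y
    polar-negʳ x y = begin
      polar F q x (-ᵥ y)        ≡⟨ cong (polar F q x) (-ᵥ≡-1·ᵥ y) ⟩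
      polar F q x (- 1# ·ᵥ y)   ≡⟨ scaleʳ (- 1#) x y ⟩
      - 1# * polar F q x y      ≡⟨ -1*x≈-x _ ⟩
      - polar F q x y           ∎

    q-+ᵥ-·ᵥ : ∀ p l e → q (p +ᵥ l ·ᵥ e) ≡ q p + (l * l * q e + l * polar F q p e)
    q-+ᵥ-·ᵥ p l e = begin
      q (p +ᵥ l ·ᵥ e)                                   ≡⟨ q-+ᵥ p (l ·ᵥ e) ⟩
      q p + q (l ·ᵥ e) + polar F q p (l ·ᵥ e)           ≡⟨ cong₂ (λ s t → q p + s + t) (homog l e) (scaleʳ l p e) ⟩
      q p + l * l * q e + l * polar F q p e             ≡⟨ +-assoc _ _ _ ⟩
      q p + (l * l * q e + l * polar F q p e)           ∎

    second-intersection : ∀ {p l e} → q e ≢ 0# → l ≢ 0# → q (p +ᵥ l ·ᵥ e) ≡ q p →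
                          l ≡ - polar F q p e * q e ⁻¹
    second-intersection {p} {l} {e} qe≢0 l≢0 same-value =
      x*y≡z⇒x≡z*y⁻¹ qe≢0 (inverseˡ-unique _ _ (*-cancelˡ l≢0 (begin
        l * (l * q e + polar F q p e)       ≡⟨ distribˡ l _ _ ⟩
        l * (l * q e) + l * polar F q p e   ≡⟨ cong (_+ l * polar F q p e) (sym (*-assoc l l (q e))) ⟩
        l * l * q e + l * polar F q p e     ≡⟨ identityʳ-unique (q p) _ (trans (sym (q-+ᵥ-·ᵥ p l e)) same-value) ⟩
        0#                                  ≡⟨ sym (zeroʳ l) ⟩
        l * 0#                              ∎)))

    q[z-c·d]≡q[z]⇒polar≡c*q[d] : ∀ {c z d} → c ≢ 0# → q (z -ᵥ c ·ᵥ d) ≡ q z → polar F q z d ≡ c * q d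
    q[z-c·d]≡q[z]⇒polar≡c*q[d] {c} {z} {d} c≢0 same-value = sym (*-cancelˡ c≢0 (begin
      c * (c * q d)         ≡⟨ sym (*-assoc c c (q d)) ⟩
      c * c * q d           ≡⟨ x∙y⁻¹≈ε⇒x≈y _ _ (identityʳ-unique (q z) _ expansion) ⟩
      c * polar F q z d     ∎))
      where
      expansion : q z + (c * c * q d + - (c * polar F q z d)) ≡ q z
      expansion = begin
        q z + (c * c * q d + - (c * polar F q z d))       ≡⟨ sym (+-assoc _ _ _) ⟩
        q z + c * c * q d + - (c * polar F q z d)         ≡⟨ cong₂ (λ s t → q z + s + t) q[-c·d] polar[z,-c·d] ⟨
        q z + q (-ᵥ c ·ᵥ d) + polar F q z (-ᵥ c ·ᵥ d)     ≡⟨ q-+ᵥ z (-ᵥ c ·ᵥ d) ⟨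
        q (z -ᵥ c ·ᵥ d)                                   ≡⟨ same-value ⟩
        q z                                               ∎
        where
        q[-c·d] = trans (q-neg (c ·ᵥ d)) (homog c d)
        polar[z,-c·d] = trans (polar-negʳ z (c ·ᵥ d)) (cong -_ (scaleʳ c z d))

    module _ (aniso : Anisotropic F q) where

      q≡0⇒≡0ᵥ : ∀ {v} → q v ≡ 0# → v ≡ 0ᵥ
      q≡0⇒≡0ᵥ {v} qv≡0 with v ≟ᵥ 0ᵥ
      ... | yes v≡0 = v≡0
      ... | no v≢0  = ⊥-elim (aniso v v≢0 qv≡0)

      fibre-atMost : ∀ r → AtMost (2 ℕ.+ size) (λ x → q x ≡ r)
      fibre-atMost r with any?-from-enum enumV (λ p → q p ≟ r)
      ... | no ∄p          = [] , z≤n , λ {x} qx≡r → ⊥-elim (∄p (x , qx≡r))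
      ... | yes (p , refl) =
        p ∷ map secondPoint directions ,
        ≤-reflexive (cong suc (trans (length-map secondPoint directions) length-directions)) ,
        on-some-line
        where
        secondPoint : V F → V F
        secondPoint e = p +ᵥ (- polar F q p e * q e ⁻¹) ·ᵥ e

        on-some-line : ∀ {x} → q x ≡ q p → x ∈ p ∷ map secondPoint directions
        on-some-line {x} qx≡qp with x ≟ᵥ p
        ... | yes x≡p = here x≡p
        ... | no x≢p with ≢0ᵥ⇒multiple-of-direction (x≢p ∘ -ᵥ≡0ᵥ⇒≡)
        ... | l , e , e∈ , l≢0 , x-p≡l·e =
          there (subst (_∈ map secondPoint directions) (sym x≡secondPoint) (∈-map⁺ secondPoint e∈))
          where
          x≡p+l·e : x ≡ p +ᵥ l ·ᵥ e
          x≡p+l·e = trans (sym (+ᵥ-sub p x)) (cong (p +ᵥ_) x-p≡l·e)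
          x≡secondPoint : x ≡ secondPoint e
          x≡secondPoint = trans x≡p+l·e (cong (λ t → p +ᵥ t ·ᵥ e)
            (second-intersection (aniso e (direction-≢0ᵥ e∈)) l≢0 (trans (cong q (sym x≡p+l·e)) qx≡qp)))

      -- The hypotheses make q (z +ᵥ d) vanish, so z ≡ -ᵥ d by anisotropy.
      q[z-c·d]≡q[z]⇒q[z]≡q[d] : ∀ {c z d} → c ≢ 0# → c * q d ≡ - (q d + q z) →
                                q (z -ᵥ c ·ᵥ d) ≡ q z → q z ≡ q d
      q[z-c·d]≡q[z]⇒q[z]≡q[d] {c} {z} {d} c≢0 c*q[d]≡ same-value = begin
        q z          ≡⟨ cong q (+ᵥ≡0ᵥ⇒≡-ᵥ (q≡0⇒≡0ᵥ q[z+d]≡0)) ⟩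
        q (-ᵥ d)     ≡⟨ q-neg d ⟩
        q d          ∎
        where
        q[z+d]≡0 : q (z +ᵥ d) ≡ 0#
        q[z+d]≡0 = begin
          q (z +ᵥ d)                        ≡⟨ q-+ᵥ z d ⟩
          q z + q d + polar F q z d         ≡⟨ cong (q z + q d +_) (trans (q[z-c·d]≡q[z]⇒polar≡c*q[d] c≢0 same-value) c*q[d]≡) ⟩
          q z + q d + - (q d + q z)         ≡⟨ cong (λ t → t + - (q d + q z)) (+-comm (q z) (q d)) ⟩
          q d + q z + - (q d + q z)         ≡⟨ -‿inverseʳ _ ⟩
          0#                                ∎

      diamAtLeast3 : ∀ a d → ¬ BadValue a (q d) → DiamAtLeast (Adj F q a) 3
      diamAtLeast3 a d good = no-short-walk⇒diamAtLeast3 0ᵥ≢y ¬0ᵥ~y ¬0ᵥ~z~y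
        where
        c = farScale a (q d)
        y = c ·ᵥ d

        0ᵥ≢y : 0ᵥ ≢ y
        0ᵥ≢y 0ᵥ≡y = farScale²*n≢0 good (trans (sym (homog c d)) (trans (cong q (sym 0ᵥ≡y)) q-0ᵥ))

        ¬0ᵥ~y : ¬ Adj F q a 0ᵥ y
        ¬0ᵥ~y (_ , q[0-y]≡a) = farScale²*n≢a good (trans (sym (homog c d)) (trans (sym (q-0ᵥ-ᵥ y)) q[0-y]≡a))

        ¬0ᵥ~z~y : ∀ {z} → Adj F q a 0ᵥ z → ¬ Adj F q a z y
        ¬0ᵥ~z~y {z} (_ , q[0-z]≡a) (_ , q[z-y]≡a) = good (inj₂ (inj₁ (begin
          q d   ≡⟨ q[z-c·d]≡q[z]⇒q[z]≡q[d] (farScale≢0 good) c*q[d]≡ (trans q[z-y]≡a (sym q[z]≡a)) ⟨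
          q z   ≡⟨ q[z]≡a ⟩
          a     ∎)))
          where
          q[z]≡a : q z ≡ a
          q[z]≡a = trans (sym (q-0ᵥ-ᵥ z)) q[0-z]≡a
          c*q[d]≡ : c * q d ≡ - (q d + q z)
          c*q[d]≡ = trans (farScale*n≡-[n+a] good) (cong (λ t → - (q d + t)) (sym q[z]≡a))

five-fibres<square : ∀ {s} → 7 ≤ s → 5 ℕ.* (2 ℕ.+ s) < s ℕ.* s
five-fibres<square {s} 7≤s = begin-strict
  5 ℕ.* (2 ℕ.+ s)       ≡⟨ *-distribˡ-+ 5 2 s ⟩
  10 ℕ.+ 5 ℕ.* s        <⟨ +-monoˡ-< (5 ℕ.* s) (≤-trans (m≤m+n 11 3) (*-monoʳ-≤ 2 7≤s)) ⟩
  2 ℕ.* s ℕ.+ 5 ℕ.* s   ≡⟨ *-distribʳ-+ s 2 5 ⟨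
  7 ℕ.* s               ≤⟨ *-monoˡ-≤ s 7≤s ⟩
  s ℕ.* s               ∎
  where open ≤-Reasoning

lemma3p14 : {c : Level} (F : FiniteField c) →
    7 ≤ FiniteField.size F →
    (q : V F → FiniteField.Carrier F) →
    IsQuadraticForm F q → NonDegenerate F q → Anisotropic F q →
    (a : FiniteField.Carrier F) → a ≢ FiniteField.0# F →
    DiamAtLeast (Adj F q a) 3
lemma3p14 F 7≤size q isQ _ aniso a _ =
  uncurry (diamAtLeast3 F isQ aniso a) (atMost⇒∃∁ (enumV F) bad-vectors (five-fibres<square 7≤size))
  where
  bad-vectors : AtMost (5 ℕ.* (2 ℕ.+ FiniteField.size F)) (BadValue F a ∘ q)
  bad-vectors = atMost-preimage q (badValues-atMost F a) (fibre-atMost F isQ aniso)
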